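{- Let $(H,\sigma)$ be a $K_3$-coloured graph. Then every cycle-equation in every system of $\mathrm{Eqs}(H,\sigma)$ is symmetric if and only if $(H,\sigma)$ is colour homomorphic to $P_\infty^3$.
   Context: A $K_3$-coloured graph is a graph $H$ with a proper colouring $\sigma:V(H)\to\{1,2,3\}$. For an injection $c:\{1,2,3\}\to\mathbb{Z}_{>0}$ and a cycle $v_1\dots v_\ell$ of $H$, its cycle-equation is $\sum_{i=1}^{\ell}(c(\sigma(v_{i+1}))-c(\sigma(v_i)))\,x_{v_iv_{i+1}}=0$ (indices mod $\ell$, one variable per edge); $\mathrm{Eq}(H,\sigma,c)$ is the system of all cycle-equations of $H$, and $\mathrm{Eqs}(H,\sigma)$ is the set of systems $\mathrm{Eq}(H,\sigma,c)$ over all injections $c$. An equation is symmetric if it can be written as $\sum_{i=1}^{k}a_ix_i=\sum_{i=1}^{k}a_ix_{k+i}$ for distinct variables $x_1,\dots,x_{2k}$. $P_\infty^3$ is the two-way infinite path with vertex set $\mathbb{Z}$ (edges $\{n,n+1\}$), coloured by a cyclic $3$-colouring $\phi$ with $\phi(n)\equiv\phi(n-1)+1\pmod 3$. A colour homomorphism from $(H,\sigma)$ to $P_\infty^3$ is a graph homomorphism $\gamma$ with $\phi(\gamma(v))=\sigma(v)$ for all $v$. -}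

module Defs where

open import Data.Nat using (ℕ; _<_; _≤_)
open import Data.Integer as ℤ using (ℤ; +_; -_; _-_)
open import Data.Fin using (Fin; zero; suc)
open import Data.Bool using (Bool; true)
open import Data.List using (List; []; _∷_; _++_; [_]; map; zip; length)
open import Data.List.Relation.Unary.All using (All)
open import Data.List.Relation.Unary.Unique.Propositional using (Unique)
open import Data.List.Relation.Binary.Permutation.Propositional using (_↭_)
open import Data.Product using (Σ; _×_; _,_; ∃)
open import Data.Sum using (_⊎_)
import Data.Empty
open import Function.Definitions using (Injective)
open import Relation.Binary.PropositionalEquality using (_≡_; _≢_)

-- Colours {1,2,3} are represented by Fin 3 (colour i+1 ↔ i).

record Graph : Set where
  field
    n     : ℕ
    adj   : Fin n → Fin n → Bool
    sym   : ∀ u v → adj u v ≡ adj v u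
    irrfl : ∀ v → adj v v ≡ true → Data.Empty.⊥

open Graph public

Adj : (H : Graph) → Fin (n H) → Fin (n H) → Set
Adj H u v = adj H u v ≡ true

ProperColouring : (H : Graph) → (Fin (n H) → Fin 3) → Set
ProperColouring H σ = ∀ u v → Adj H u v → σ u ≢ σ v

cyclicPairs : {A : Set} → List A → List (A × A)
cyclicPairs []       = []
cyclicPairs (v ∷ vs) = zip (v ∷ vs) (vs ++ [ v ])

IsCycle : (H : Graph) → List (Fin (n H)) → Set
IsCycle H vs =
  (3 ≤ length vs) × Unique vs × All (λ p → Adj H (Data.Product.proj₁ p) (Data.Product.proj₂ p)) (cyclicPairs vs)

IsColourInjection : (Fin 3 → ℕ) → Set
IsColourInjection c = Injective _≡_ _≡_ c × (∀ i → 0 < c i)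

-- A linear equation Σ aᵢ xᵢ = 0 is the list of its terms (aᵢ , xᵢ);
-- the variable attached to the edge v_i v_{i+1} is named by the pair.
Equation : Set → Set
Equation Var = List (ℤ × Var)

cycleEquation : (H : Graph) → (Fin (n H) → Fin 3) → (Fin 3 → ℕ) →
                List (Fin (n H)) → Equation (Fin (n H) × Fin (n H))
cycleEquation H σ c vs =
  map (λ p → ((+ c (σ (Data.Product.proj₂ p))) - (+ c (σ (Data.Product.proj₁ p))) , p))
      (cyclicPairs vs)

-- Symmetric: the equation can be written as
-- Σ_{i=1}^k aᵢ xᵢ = Σ_{i=1}^k aᵢ x_{k+i}, i.e. Σ aᵢ xᵢ − Σ aᵢ x_{k+i} = 0,
-- with x₁,…,x_{2k} distinct; given by the list of triples (aᵢ , xᵢ , x_{k+i}).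
Symmetric : {Var : Set} → Equation Var → Set
Symmetric {Var} e =
  Σ (List (ℤ × Var × Var)) λ ts →
    Unique (map (λ t → Data.Product.proj₁ (Data.Product.proj₂ t)) ts
            ++ map (λ t → Data.Product.proj₂ (Data.Product.proj₂ t)) ts)
    × (e ↭ (map (λ t → (Data.Product.proj₁ t , Data.Product.proj₁ (Data.Product.proj₂ t))) ts
            ++ map (λ t → (- Data.Product.proj₁ t , Data.Product.proj₂ (Data.Product.proj₂ t))) ts))

next3 : Fin 3 → Fin 3
next3 zero             = suc zero
next3 (suc zero)       = suc (suc zero)
next3 (suc (suc zero)) = zero

IsCyclicColouring : (ℤ → Fin 3) → Set
IsCyclicColouring φ = ∀ m → φ m ≡ next3 (φ (m ℤ.- ℤ.+ 1))

AdjP∞ : ℤ → ℤ → Set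
AdjP∞ a b = (b ≡ a ℤ.+ ℤ.+ 1) ⊎ (a ≡ b ℤ.+ ℤ.+ 1)

ColourHom : (H : Graph) → (Fin (n H) → Fin 3) → (ℤ → Fin 3) → (Fin (n H) → ℤ) → Set
ColourHom H σ φ γ = (∀ u v → Adj H u v → AdjP∞ (γ u) (γ v)) × (∀ v → φ (γ v) ≡ σ v)

ColourHomomorphic : (H : Graph) → (Fin (n H) → Fin 3) → (ℤ → Fin 3) → Set
ColourHomomorphic H σ φ = ∃ λ γ → ColourHom H σ φ γ

{-# OPTIONS --safe #-}
-- Orient every edge uv of H by the sign ±1 of the step σ(u) → σ(v) in the
-- cyclic order of the colours.  With colour values 1, 2, 4 these signs are an
-- odd function of the coefficients of a cycle-equation, so a symmetric
-- cycle-equation has winding number 0.  Conversely, if every cycle has winding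
-- number 0, the edges can be added one at a time to an embedding into P∞: an
-- edge inside a component closes a cycle and is therefore already realised,
-- and an edge between two components is realised by translating one of them.
--
-- Given a colour homomorphism γ, every edge of a cycle that is mapped onto
-- {m, m+1} has the coefficient ±(c(φ(m+1)) − c(φ(m))), the sign being the
-- direction of traversal, and a closed walk traverses each edge of P∞ equally
-- often in both directions.  Pairing opposite traversals exhibits the
-- cycle-equation as symmetric.
module Submission where

open import Defs hiding (sym)
open import Data.Nat using (ℕ; zero; suc; s≤s; z≤n)
import Data.Nat as ℕ
import Data.Nat.Properties as ℕP
open import Data.Integer using (ℤ; +_; -[1+_]; -_; _-_; _+_; 0ℤ; 1ℤ; -1ℤ; +≤+; _<_; _≤_; _<?_)
import Data.Integer.Properties as ℤP
open import Data.Integer.Tactic.RingSolver using (solve-∀)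
open import Algebra.Properties.CommutativeSemigroup ℤP.+-commutativeSemigroup using (x∙yz≈y∙xz; xy∙z≈xz∙y)
open import Data.Fin using (Fin; zero; suc)
import Data.Fin.Properties as FinP
open import Data.Bool using (Bool; true; false; not; if_then_else_)
import Data.Bool.Properties as BoolP
open import Data.List using (List; []; _∷_; _++_; [_]; map; zip; length; cartesianProduct; allFin)
import Data.List.Properties as ListP
open import Data.List.Relation.Unary.All as All using (All; []; _∷_)
import Data.List.Relation.Unary.All.Properties as AllP
open import Data.List.Relation.Unary.Any using (here; there; any?)
open import Data.List.Relation.Unary.Unique.Propositional using (Unique)
open import Data.List.Relation.Unary.AllPairs using ([]; _∷_)
import Data.List.Relation.Unary.Unique.Propositional.Properties as UniqueP
open import Data.List.Relation.Binary.Permutation.Propositional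
  using (_↭_; ↭-refl; ↭-trans; ↭-sym; ↭⇒↭ₛ)
import Data.List.Relation.Binary.Permutation.Propositional.Properties as PermP
import Data.List.Relation.Binary.Permutation.Setoid.Properties as PermSetoidP
open import Data.List.Membership.Propositional using (_∈_; find)
import Data.List.Membership.Propositional.Properties as MemP
open import Data.Product using (Σ; _×_; _,_; ∃; ∃₂; proj₁; proj₂)
import Data.Product.Properties as ProdP
open import Data.Sum using (_⊎_; inj₁; inj₂)
import Data.Sum as Sum
open import Data.Empty using (⊥-elim)
open import Function using (_∘_)
open import Relation.Nullary using (¬_; Dec; yes; no; does; contradiction)
open import Relation.Binary.Definitions using (DecidableEquality; tri<; tri≈; tri>)
open import Relation.Binary.PropositionalEquality
  using (_≡_; _≢_; refl; sym; trans; cong; cong₂; subst; subst₂; setoid; module ≡-Reasoning)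

difference-swap : ∀ a b → a - b ≡ - (b - a)
difference-swap = solve-∀

+-minus-cancel : ∀ a b → a + (b - a) ≡ b
+-minus-cancel = solve-∀

sumMap : {A : Set} → (A → ℤ) → List A → ℤ
sumMap f []       = 0ℤ
sumMap f (x ∷ xs) = f x + sumMap f xs

module _ {A : Set} where

  sumMap-++ : (f : A → ℤ) (xs ys : List A) → sumMap f (xs ++ ys) ≡ sumMap f xs + sumMap f ys
  sumMap-++ f []       ys = sym (ℤP.+-identityˡ _)
  sumMap-++ f (x ∷ xs) ys = trans (cong (_+_ (f x)) (sumMap-++ f xs ys)) (sym (ℤP.+-assoc (f x) _ _))

  sumMap-↭ : (f : A → ℤ) {xs ys : List A} → xs ↭ ys → sumMap f xs ≡ sumMap f ys
  sumMap-↭ f _↭_.refl         = refl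
  sumMap-↭ f (_↭_.prep x p)   = cong (_+_ (f x)) (sumMap-↭ f p)
  sumMap-↭ f (_↭_.swap x y p) = trans (x∙yz≈y∙xz (f x) (f y) _) (cong (λ s → f y + (f x + s)) (sumMap-↭ f p))
  sumMap-↭ f (_↭_.trans p q)  = trans (sumMap-↭ f p) (sumMap-↭ f q)

  sumMap-cong : {f g : A → ℤ} {xs : List A} → All (λ x → f x ≡ g x) xs → sumMap f xs ≡ sumMap g xs
  sumMap-cong []       = refl
  sumMap-cong (e ∷ es) = cong₂ _+_ e (sumMap-cong es)

  sumMap-neg : (f : A → ℤ) (xs : List A) → sumMap (λ x → - f x) xs ≡ - sumMap f xs
  sumMap-neg f []       = refl
  sumMap-neg f (x ∷ xs) = trans (cong (_+_ (- f x)) (sumMap-neg f xs)) (sym (ℤP.neg-distrib-+ (f x) _))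

  sumMap-map : {B : Set} (f : B → ℤ) (g : A → B) (xs : List A) → sumMap f (map g xs) ≡ sumMap (f ∘ g) xs
  sumMap-map f g []       = refl
  sumMap-map f g (x ∷ xs) = cong (_+_ (f (g x))) (sumMap-map f g xs)

  sumMap-nonneg : {f : A → ℤ} {xs : List A} → All (λ x → 0ℤ ≤ f x) xs → 0ℤ ≤ sumMap f xs
  sumMap-nonneg []       = ℤP.≤-refl
  sumMap-nonneg (p ∷ ps) = ℤP.+-mono-≤ p (sumMap-nonneg ps)

  difference : (A → ℤ) → A × A → ℤ
  difference h (x , y) = h y - h x

  sumMap-difference-zip : (h : A → ℤ) (x : A) (xs : List A) (w : A) →
    sumMap (difference h) (zip (x ∷ xs) (xs ++ [ w ])) ≡ h w - h x
  sumMap-difference-zip h x []       w = ℤP.+-identityʳ _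
  sumMap-difference-zip h x (y ∷ xs) w =
    trans (cong (_+_ (h y - h x)) (sumMap-difference-zip h y xs w)) (telescope (h x) (h y) (h w))
    where
    telescope : ∀ a b c → (b - a) + (c - b) ≡ c - a
    telescope = solve-∀

  sumMap-difference-cyclicPairs : (h : A → ℤ) (vs : List A) →
    sumMap (difference h) (cyclicPairs vs) ≡ 0ℤ
  sumMap-difference-cyclicPairs h []       = refl
  sumMap-difference-cyclicPairs h (v ∷ vs) =
    trans (sumMap-difference-zip h v vs v) (ℤP.+-inverseʳ (h v))

  map-proj₁-zip : (x : A) (xs : List A) (w : A) → map proj₁ (zip (x ∷ xs) (xs ++ [ w ])) ≡ x ∷ xs
  map-proj₁-zip x []       w = refl
  map-proj₁-zip x (y ∷ xs) w = cong (x ∷_) (map-proj₁-zip y xs w)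

  Unique-cyclicPairs : {vs : List A} → Unique vs → Unique (cyclicPairs vs)
  Unique-cyclicPairs {[]}     _  = []
  Unique-cyclicPairs {v ∷ vs} uq = UniqueP.map⁻ (subst Unique (sym (map-proj₁-zip v vs v)) uq)

  ↭-pair : (u v : A) (ys zs : List A) {ls rs : List A} → ys ++ zs ↭ ls ++ rs →
    u ∷ ys ++ v ∷ zs ↭ u ∷ ls ++ v ∷ rs
  ↭-pair u v ys zs {ls} {rs} p =
    _↭_.prep u (↭-trans (PermP.shift v ys zs) (↭-trans (_↭_.prep v p) (↭-sym (PermP.shift v ls rs))))

  Unique-resp-↭ : {xs ys : List A} → xs ↭ ys → Unique xs → Unique ys
  Unique-resp-↭ p = PermSetoidP.Unique-resp-↭ (setoid A) (↭⇒↭ₛ p)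

AdjacentPairs : (H : Graph) → List (Fin (n H) × Fin (n H)) → Set
AdjacentPairs H = All (λ p → Adj H (proj₁ p) (proj₂ p))

pattern 𝟎 = zero
pattern 𝟏 = suc zero
pattern 𝟐 = suc (suc zero)

orient : Fin 3 → Fin 3 → ℤ
orient 𝟎 𝟏 = 1ℤ
orient 𝟏 𝟐 = 1ℤ
orient 𝟐 𝟎 = 1ℤ
orient _ _ = -1ℤ

orient-next3 : ∀ a → orient a (next3 a) ≡ 1ℤ
orient-next3 𝟎 = refl
orient-next3 𝟏 = refl
orient-next3 𝟐 = refl

orient-next3˘ : ∀ a → orient (next3 a) a ≡ -1ℤ
orient-next3˘ 𝟎 = refl
orient-next3˘ 𝟏 = refl
orient-next3˘ 𝟐 = refl

orient-view : ∀ {a b} → a ≢ b →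
  (b ≡ next3 a × orient a b ≡ 1ℤ) ⊎ (a ≡ next3 b × orient a b ≡ -1ℤ)
orient-view {𝟎} {𝟏} _ = inj₁ (refl , refl)
orient-view {𝟏} {𝟐} _ = inj₁ (refl , refl)
orient-view {𝟐} {𝟎} _ = inj₁ (refl , refl)
orient-view {𝟏} {𝟎} _ = inj₂ (refl , refl)
orient-view {𝟐} {𝟏} _ = inj₂ (refl , refl)
orient-view {𝟎} {𝟐} _ = inj₂ (refl , refl)
orient-view {𝟎} {𝟎} a≢b = contradiction refl a≢b
orient-view {𝟏} {𝟏} a≢b = contradiction refl a≢b
orient-view {𝟐} {𝟐} a≢b = contradiction refl a≢b

orient-±1 : ∀ {a b} → a ≢ b → orient a b ≡ 1ℤ ⊎ orient a b ≡ -1ℤ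
orient-±1 a≢b = Sum.map proj₂ proj₂ (orient-view a≢b)

next3³ : ∀ a → next3 (next3 (next3 a)) ≡ a
next3³ 𝟎 = refl
next3³ 𝟏 = refl
next3³ 𝟐 = refl

next3-injective : ∀ {a b} → next3 a ≡ next3 b → a ≡ b
next3-injective {a} {b} e = trans (sym (next3³ a)) (trans (cong (next3 ∘ next3) e) (next3³ b))

next3-orbit : ∀ a b → (b ≡ a) ⊎ (b ≡ next3 a) ⊎ (b ≡ next3 (next3 a))
next3-orbit 𝟎 𝟎 = inj₁ refl
next3-orbit 𝟎 𝟏 = inj₂ (inj₁ refl)
next3-orbit 𝟎 𝟐 = inj₂ (inj₂ refl)
next3-orbit 𝟏 𝟎 = inj₂ (inj₂ refl)
next3-orbit 𝟏 𝟏 = inj₁ refl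
next3-orbit 𝟏 𝟐 = inj₂ (inj₁ refl)
next3-orbit 𝟐 𝟎 = inj₂ (inj₁ refl)
next3-orbit 𝟐 𝟏 = inj₂ (inj₂ refl)
next3-orbit 𝟐 𝟐 = inj₁ refl

-- With the colour values 1, 2, 4 the coefficient c(b) − c(a) of an edge
-- determines orient a b: it is one of 1, 2, −3 going forwards and one of
-- −1, −2, 3 going backwards.
c₀ : Fin 3 → ℕ
c₀ 𝟎 = 1
c₀ 𝟏 = 2
c₀ 𝟐 = 4

c₀-isColourInjection : IsColourInjection c₀
c₀-isColourInjection = injective , (λ { 𝟎 → s≤s z≤n ; 𝟏 → s≤s z≤n ; 𝟐 → s≤s z≤n })
  where
  injective : ∀ {a b} → c₀ a ≡ c₀ b → a ≡ b
  injective {𝟎} {𝟎} _ = refl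
  injective {𝟏} {𝟏} _ = refl
  injective {𝟐} {𝟐} _ = refl
  injective {𝟎} {𝟏} ()
  injective {𝟎} {𝟐} ()
  injective {𝟏} {𝟎} ()
  injective {𝟏} {𝟐} ()
  injective {𝟐} {𝟎} ()
  injective {𝟐} {𝟏} ()

decodeOrient : ℤ → ℤ
decodeOrient (+ 1)    = 1ℤ
decodeOrient (+ 2)    = 1ℤ
decodeOrient -[1+ 2 ] = 1ℤ
decodeOrient -[1+ 0 ] = -1ℤ
decodeOrient -[1+ 1 ] = -1ℤ
decodeOrient (+ 3)    = -1ℤ
decodeOrient _        = 0ℤ

decodeOrient-odd : ∀ d → decodeOrient (- d) ≡ - decodeOrient d
decodeOrient-odd (+ 0)                        = refl
decodeOrient-odd (+ 1)                        = refl
decodeOrient-odd (+ 2)                        = refl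
decodeOrient-odd (+ 3)                        = refl
decodeOrient-odd (+ suc (suc (suc (suc _)))) = refl
decodeOrient-odd -[1+ 0 ]                     = refl
decodeOrient-odd -[1+ 1 ]                     = refl
decodeOrient-odd -[1+ 2 ]                     = refl
decodeOrient-odd -[1+ suc (suc (suc _)) ]     = refl

decodeOrient-c₀ : ∀ {a b} → a ≢ b → decodeOrient (+ c₀ b - + c₀ a) ≡ orient a b
decodeOrient-c₀ {𝟎} {𝟏} _ = refl
decodeOrient-c₀ {𝟏} {𝟐} _ = refl
decodeOrient-c₀ {𝟐} {𝟎} _ = refl
decodeOrient-c₀ {𝟏} {𝟎} _ = refl
decodeOrient-c₀ {𝟐} {𝟏} _ = refl
decodeOrient-c₀ {𝟎} {𝟐} _ = refl
decodeOrient-c₀ {𝟎} {𝟎} a≢b = contradiction refl a≢b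
decodeOrient-c₀ {𝟏} {𝟏} a≢b = contradiction refl a≢b
decodeOrient-c₀ {𝟐} {𝟐} a≢b = contradiction refl a≢b

module _ {Var : Set} where

  lhsTerm rhsTerm : ℤ × Var × Var → ℤ × Var
  lhsTerm (a , x , _) = a , x
  rhsTerm (a , _ , y) = - a , y

  pairing⇒Symmetric : {e : Equation Var} {ts : List (ℤ × Var × Var)} →
    Unique (map proj₂ e) → e ↭ map lhsTerm ts ++ map rhsTerm ts → Symmetric e
  pairing⇒Symmetric {e} {ts} unique e↭ = ts , subst Unique variables (Unique-resp-↭ (PermP.map⁺ proj₂ e↭) unique) , e↭
    where
    variables : map proj₂ (map lhsTerm ts ++ map rhsTerm ts) ≡ map (proj₁ ∘ proj₂) ts ++ map (proj₂ ∘ proj₂) ts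
    variables = trans (ListP.map-++ proj₂ (map lhsTerm ts) _) (cong₂ _++_ (sym (ListP.map-∘ ts)) (sym (ListP.map-∘ ts)))

  sumMap-odd-Symmetric : (f : ℤ → ℤ) → (∀ d → f (- d) ≡ - f d) →
    {e : Equation Var} → Symmetric e → sumMap (f ∘ proj₁) e ≡ 0ℤ
  sumMap-odd-Symmetric f f-odd {e} (ts , _ , e↭) = begin
    sumMap (f ∘ proj₁) e
      ≡⟨ sumMap-↭ (f ∘ proj₁) e↭ ⟩
    sumMap (f ∘ proj₁) (map lhsTerm ts ++ map rhsTerm ts)
      ≡⟨ sumMap-++ (f ∘ proj₁) (map lhsTerm ts) (map rhsTerm ts) ⟩
    sumMap (f ∘ proj₁) (map lhsTerm ts) + sumMap (f ∘ proj₁) (map rhsTerm ts)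
      ≡⟨ cong₂ _+_ (sumMap-map (f ∘ proj₁) lhsTerm ts) (sumMap-map (f ∘ proj₁) rhsTerm ts) ⟩
    S + sumMap (λ t → f (- proj₁ t)) ts
      ≡⟨ cong (_+_ S) (trans (sumMap-cong (All.universal (f-odd ∘ proj₁) ts)) (sumMap-neg (f ∘ proj₁) ts)) ⟩
    S - S
      ≡⟨ ℤP.+-inverseʳ S ⟩
    0ℤ ∎
    where
    open ≡-Reasoning
    S = sumMap (f ∘ proj₁) ts

AdjP∞-sym : ∀ {a b} → AdjP∞ a b → AdjP∞ b a
AdjP∞-sym (inj₁ e) = inj₂ e
AdjP∞-sym (inj₂ e) = inj₁ e

AdjP∞-+±1 : ∀ {a s} → s ≡ 1ℤ ⊎ s ≡ -1ℤ → AdjP∞ a (a + s)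
AdjP∞-+±1     (inj₁ refl) = inj₁ refl
AdjP∞-+±1 {a} (inj₂ refl) = inj₂ (pred-suc a)
  where
  pred-suc : ∀ a → a ≡ (a + -1ℤ) + 1ℤ
  pred-suc = solve-∀

AdjP∞-±1 : ∀ {a b s} → s ≡ 1ℤ ⊎ s ≡ -1ℤ → (a - b) + s ≡ 0ℤ → AdjP∞ a b
AdjP∞-±1 {a} {b} (inj₁ refl) e = inj₁ (begin
  b                        ≡⟨ isolate-b a b ⟩
  (a + 1ℤ) - ((a - b) + 1ℤ) ≡⟨ cong (λ z → (a + 1ℤ) - z) e ⟩
  (a + 1ℤ) - 0ℤ            ≡⟨ ℤP.+-identityʳ (a + 1ℤ) ⟩
  a + 1ℤ                   ∎)
  where
  open ≡-Reasoning
  isolate-b : ∀ a b → b ≡ (a + 1ℤ) - ((a - b) + 1ℤ)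
  isolate-b = solve-∀
AdjP∞-±1 {a} {b} (inj₂ refl) e = inj₂ (begin
  a                         ≡⟨ isolate-a a b ⟩
  (b + 1ℤ) + ((a - b) + -1ℤ) ≡⟨ cong (_+_ (b + 1ℤ)) e ⟩
  (b + 1ℤ) + 0ℤ             ≡⟨ ℤP.+-identityʳ (b + 1ℤ) ⟩
  b + 1ℤ                    ∎)
  where
  open ≡-Reasoning
  isolate-a : ∀ a b → a ≡ (b + 1ℤ) + ((a - b) + -1ℤ)
  isolate-a = solve-∀

AdjP∞-translate : ∀ {a b} t → AdjP∞ a b → AdjP∞ (a + t) (b + t)
AdjP∞-translate {a} t (inj₁ refl) = inj₁ (xy∙z≈xz∙y a 1ℤ t)
AdjP∞-translate {_} {b} t (inj₂ refl) = inj₂ (xy∙z≈xz∙y b 1ℤ t)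

module CyclicColouring (φ : ℤ → Fin 3) (cyclic : IsCyclicColouring φ) where

  φ-suc : ∀ m → φ (m + 1ℤ) ≡ next3 (φ m)
  φ-suc m = trans (cyclic (m + 1ℤ)) (cong (next3 ∘ φ) (+1-1 m))
    where
    +1-1 : ∀ m → m + 1ℤ - 1ℤ ≡ m
    +1-1 = solve-∀

  private
    φ-translate-suc : ∀ {a b} → φ a ≡ φ b → φ (a + 1ℤ) ≡ φ (b + 1ℤ)
    φ-translate-suc {a} {b} e = trans (φ-suc a) (trans (cong next3 e) (sym (φ-suc b)))

    φ-translate-pred : ∀ {a b} → φ a ≡ φ b → φ (a - 1ℤ) ≡ φ (b - 1ℤ)
    φ-translate-pred {a} {b} e = next3-injective (trans (sym (cyclic a)) (trans e (cyclic b)))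

    shift-suc : ∀ a n → a + + suc n ≡ (a + 1ℤ) + + n
    shift-suc a n = reassoc a (+ n)
      where
      reassoc : ∀ a k → a + (1ℤ + k) ≡ (a + 1ℤ) + k
      reassoc = solve-∀

    shift-pred : ∀ a n → a + -[1+ suc n ] ≡ (a - 1ℤ) + -[1+ n ]
    shift-pred a n = reassoc a -[1+ n ]
      where
      reassoc : ∀ a k → a + (-1ℤ + k) ≡ (a - 1ℤ) + k
      reassoc = solve-∀

  φ-translate : ∀ {a b} → φ a ≡ φ b → ∀ k → φ (a + k) ≡ φ (b + k)
  φ-translate {a} {b} e (+ zero) =
    subst₂ (λ x y → φ x ≡ φ y) (sym (ℤP.+-identityʳ a)) (sym (ℤP.+-identityʳ b)) e
  φ-translate {a} {b} e (+ suc n) =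
    subst₂ (λ x y → φ x ≡ φ y) (sym (shift-suc a n)) (sym (shift-suc b n)) (φ-translate (φ-translate-suc e) (+ n))
  φ-translate e -[1+ zero ] = φ-translate-pred e
  φ-translate {a} {b} e -[1+ suc n ] =
    subst₂ (λ x y → φ x ≡ φ y) (sym (shift-pred a n)) (sym (shift-pred b n)) (φ-translate (φ-translate-pred e) -[1+ n ])

  φ-period : ∀ {b t} → φ (b + t) ≡ φ b → ∀ a → φ (a + t) ≡ φ a
  φ-period {b} {t} e a = subst₂ (λ x y → φ x ≡ φ y) (move b t a) (+-minus-cancel b a) (φ-translate e (a - b))
    where
    move : ∀ b t a → (b + t) + (a - b) ≡ a + t
    move = solve-∀

  orient-AdjP∞ : ∀ {a b} → AdjP∞ a b → orient (φ a) (φ b) ≡ b - a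
  orient-AdjP∞ {a} (inj₁ refl) = begin
    orient (φ a) (φ (a + 1ℤ)) ≡⟨ cong (orient (φ a)) (φ-suc a) ⟩
    orient (φ a) (next3 (φ a)) ≡⟨ orient-next3 (φ a) ⟩
    1ℤ                         ≡⟨ step-up a ⟩
    a + 1ℤ - a                 ∎
    where
    open ≡-Reasoning
    step-up : ∀ a → 1ℤ ≡ a + 1ℤ - a
    step-up = solve-∀
  orient-AdjP∞ {_} {b} (inj₂ refl) = begin
    orient (φ (b + 1ℤ)) (φ b)  ≡⟨ cong (λ c → orient c (φ b)) (φ-suc b) ⟩
    orient (next3 (φ b)) (φ b) ≡⟨ orient-next3˘ (φ b) ⟩
    -1ℤ                        ≡⟨ step-down b ⟩
    b - (b + 1ℤ)               ∎
    where
    open ≡-Reasoning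
    step-down : ∀ b → -1ℤ ≡ b - (b + 1ℤ)
    step-down = solve-∀

  φ-orient : ∀ {m t} → φ m ≢ t → φ (m + orient (φ m) t) ≡ t
  φ-orient {m} {t} φm≢t with orient-view φm≢t
  ... | inj₁ (t≡next , o≡1)  rewrite o≡1 = trans (φ-suc m) (sym t≡next)
  ... | inj₂ (φm≡next , o≡-1) rewrite o≡-1 = next3-injective (trans (sym (cyclic m)) φm≡next)

  φ-surjective : ∀ t → ∃ λ m → φ m ≡ t
  φ-surjective t with next3-orbit (φ 0ℤ) t
  ... | inj₁ e        = 0ℤ , sym e
  ... | inj₂ (inj₁ e) = 1ℤ , trans (φ-suc 0ℤ) (sym e)
  ... | inj₂ (inj₂ e) = + 2 , trans (φ-suc 1ℤ) (trans (cong next3 (φ-suc 0ℤ)) (sym e))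

private variable
  P Q : Set

indicator : Dec P → ℤ
indicator (yes _) = 1ℤ
indicator (no _)  = 0ℤ

indicator-yes : (p : Dec P) → P → indicator p ≡ 1ℤ
indicator-yes (yes _) _  = refl
indicator-yes (no ¬p) p = contradiction p ¬p

indicator-no : (p : Dec P) → ¬ P → indicator p ≡ 0ℤ
indicator-no (yes p) ¬p = contradiction p ¬p
indicator-no (no _)  _  = refl

indicator-nonneg : (p : Dec P) → 0ℤ ≤ indicator p
indicator-nonneg (yes _) = +≤+ z≤n
indicator-nonneg (no _)  = +≤+ z≤n

indicator-⇔ : (P → Q) → (Q → P) → (p : Dec P) (q : Dec Q) → indicator p ≡ indicator q
indicator-⇔ P⇒Q Q⇒P (yes p) q = sym (indicator-yes q (P⇒Q p))
indicator-⇔ P⇒Q Q⇒P (no ¬p) q = sym (indicator-no q (¬p ∘ Q⇒P))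

module Pairing {K : Set} (_≟_ : DecidableEquality K) (op : K → K)
               (op-involutive : ∀ k → op (op k) ≡ k) (op-fixfree : ∀ k → op k ≢ k) where

  𝟙[_≡_] : K → K → ℤ
  𝟙[ x ≡ k ] = indicator (x ≟ k)

  𝟙-≡ : ∀ {x k} → x ≡ k → 𝟙[ x ≡ k ] ≡ 1ℤ
  𝟙-≡ = indicator-yes (_ ≟ _)

  𝟙-≢ : ∀ {x k} → x ≢ k → 𝟙[ x ≡ k ] ≡ 0ℤ
  𝟙-≢ = indicator-no (_ ≟ _)

  𝟙-op : ∀ x k → 𝟙[ op x ≡ k ] ≡ 𝟙[ x ≡ op k ]
  𝟙-op x k with x ≟ op k
  ... | yes refl = 𝟙-≡ (op-involutive k)
  ... | no x≢opk = 𝟙-≢ (λ opx≡k → x≢opk (trans (sym (op-involutive x)) (cong op opx≡k)))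

  𝟙-op-op : ∀ x k → 𝟙[ op x ≡ op k ] ≡ 𝟙[ x ≡ k ]
  𝟙-op-op x k = trans (𝟙-op x (op k)) (cong 𝟙[ x ≡_] (op-involutive k))

  excess : K → K → ℤ
  excess k x = 𝟙[ x ≡ k ] - 𝟙[ x ≡ op k ]

  excess-self : ∀ k → excess k k ≡ 1ℤ
  excess-self k = cong₂ _-_ (𝟙-≡ refl) (𝟙-≢ (op-fixfree k ∘ sym))

  excess-nonneg : ∀ {k x} → x ≢ op k → 0ℤ ≤ excess k x
  excess-nonneg {k} {x} x≢opk rewrite 𝟙-≢ x≢opk | ℤP.+-identityʳ 𝟙[ x ≡ k ] = indicator-nonneg (x ≟ k)

  excess-op : ∀ k x → excess (op k) x ≡ - excess k x
  excess-op k x = trans (cong (λ b → 𝟙[ x ≡ op k ] - 𝟙[ x ≡ b ]) (op-involutive k))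
                        (difference-swap 𝟙[ x ≡ op k ] 𝟙[ x ≡ k ])

  excess-cancel : ∀ j k → excess j k + excess j (op k) ≡ 0ℤ
  excess-cancel j k rewrite 𝟙-op k j | 𝟙-op-op k j = cancel 𝟙[ k ≡ j ] 𝟙[ k ≡ op j ]
    where
    cancel : ∀ a b → (a - b) + (b - a) ≡ 0ℤ
    cancel = solve-∀

  module _ {V : Set} (key : V → K) where

    Balanced : Equation V → Set
    Balanced L = ∀ k → sumMap (excess k ∘ key ∘ proj₂) L ≡ 0ℤ

    partner : ∀ {t L} → Balanced (t ∷ L) →
      ∃₂ λ ys zs → ∃ λ t′ → L ≡ ys ++ t′ ∷ zs × key (proj₂ t′) ≡ op (key (proj₂ t))
    partner {t} {L} bal with any? (λ t′ → key (proj₂ t′) ≟ op (key (proj₂ t))) L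
    ... | yes found with find found
    ...   | t′ , t′∈L , keyt′ with MemP.∈-∃++ t′∈L
    ...     | ys , zs , L≡ = ys , zs , t′ , L≡ , keyt′
    partner {t} {L} bal | no missing = contradiction (sym (bal k)) (ℤP.<⇒≢ 0<sum)
      where
      k = key (proj₂ t)
      0<sum : 0ℤ < sumMap (excess k ∘ key ∘ proj₂) (t ∷ L)
      0<sum rewrite excess-self k = ℤP.suc[i]≤j⇒i<j
        (ℤP.+-monoʳ-≤ 1ℤ (sumMap-nonneg (All.map excess-nonneg (AllP.¬Any⇒All¬ L missing))))

    Balanced-remove : ∀ {t t′} ys zs → key (proj₂ t′) ≡ op (key (proj₂ t)) →
      Balanced (t ∷ ys ++ t′ ∷ zs) → Balanced (ys ++ zs)
    Balanced-remove {t} {t′} ys zs keyt′ bal j = begin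
      sumMap f (ys ++ zs)                         ≡⟨ sumMap-++ f ys zs ⟩
      A + B                                       ≡⟨ sym (ℤP.+-identityˡ (A + B)) ⟩
      0ℤ + (A + B)                                ≡⟨ cong (_+ (A + B)) (sym (excess-cancel j k)) ⟩
      (excess j k + excess j (op k)) + (A + B)    ≡⟨ sym (regroup (excess j k) (excess j (op k)) A B) ⟩
      excess j k + (A + (excess j (op k) + B))    ≡⟨ cong (λ k′ → excess j k + (A + (excess j k′ + B))) (sym keyt′) ⟩
      f t + (A + (f t′ + B))                      ≡⟨ cong (_+_ (f t)) (sym (sumMap-++ f ys (t′ ∷ zs))) ⟩
      sumMap f (t ∷ ys ++ t′ ∷ zs)                ≡⟨ bal j ⟩
      0ℤ                                          ∎
      where
      open ≡-Reasoning
      f = excess j ∘ key ∘ proj₂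
      k = key (proj₂ t)
      A = sumMap f ys
      B = sumMap f zs
      regroup : ∀ x y a b → x + (a + (y + b)) ≡ (x + y) + (a + b)
      regroup = solve-∀

    module _ (g : K → ℤ) (g-op : ∀ k → g (op k) ≡ - g k) where

      HasCoefficients : Equation V → Set
      HasCoefficients = All (λ t → proj₁ t ≡ g (key (proj₂ t)))

      pairUp : ∀ L → HasCoefficients L → Balanced L →
        ∃ λ ts → L ↭ map lhsTerm ts ++ map rhsTerm ts
      pairUp L = go (length L) L ℕP.≤-refl
        where
        go : ∀ n L → length L ℕ.≤ n → HasCoefficients L → Balanced L →
          ∃ λ ts → L ↭ map lhsTerm ts ++ map rhsTerm ts
        go n       []            _           _              _   = [] , ↭-refl
        go (suc n) ((a , x) ∷ L) (s≤s |L|≤n) (a≡gx ∷ coeffs) bal with partner {a , x} {L} bal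
        ... | ys , zs , (b , y) , refl , keyy≡op =
          (a , x , y) ∷ ts ,
          subst (λ c → (a , x) ∷ ys ++ (c , y) ∷ zs ↭ (a , x) ∷ map lhsTerm ts ++ (- a , y) ∷ map rhsTerm ts)
                (sym b≡-a) (↭-pair (a , x) (- a , y) ys zs ys++zs↭)
          where
          open ≡-Reasoning
          split = AllP.++⁻ ys coeffs
          b≡-a : b ≡ - a
          b≡-a = begin
            b              ≡⟨ All.head (proj₂ split) ⟩
            g (key y)        ≡⟨ cong g keyy≡op ⟩
            g (op (key x))   ≡⟨ g-op (key x) ⟩
            - g (key x)      ≡⟨ cong -_ (sym a≡gx) ⟩
            - a            ∎
          shorter : length (ys ++ zs) ℕ.≤ n
          shorter = ℕP.<⇒≤ (subst (ℕ._≤ n) (PermP.↭-length (PermP.shift (b , y) ys zs)) |L|≤n)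
          rest : ∃ λ ts → ys ++ zs ↭ map lhsTerm ts ++ map rhsTerm ts
          rest = go n (ys ++ zs) shorter (AllP.++⁺ (proj₁ split) (All.tail (proj₂ split)))
                    (Balanced-remove {a , x} {b , y} ys zs keyy≡op bal)
          ts = proj₁ rest
          ys++zs↭ = proj₂ rest

OrientedEdge : Set
OrientedEdge = ℤ × Bool

-- (m , true) traverses the edge {m, m+1} of P∞ upwards, (m , false) downwards.
source target : OrientedEdge → ℤ
source (m , true)  = m
source (m , false) = m + 1ℤ
target (m , true)  = m + 1ℤ
target (m , false) = m

reverse : OrientedEdge → OrientedEdge
reverse (m , b) = m , not b

orientedEdge : ℤ → ℤ → OrientedEdge
orientedEdge x y with y ℤP.≟ x + 1ℤ
... | yes _ = x , true
... | no _  = y , false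

orientedEdge-endpoints : ∀ {x y} → AdjP∞ x y →
  source (orientedEdge x y) ≡ x × target (orientedEdge x y) ≡ y
orientedEdge-endpoints {x} {y} adj with y ℤP.≟ x + 1ℤ
... | yes y≡x+1 = refl , sym y≡x+1
orientedEdge-endpoints (inj₁ y≡x+1) | no y≢x+1 = contradiction y≡x+1 y≢x+1
orientedEdge-endpoints (inj₂ x≡y+1) | no _     = sym x≡y+1 , refl

_≟ᴱ_ : DecidableEquality OrientedEdge
_≟ᴱ_ = ProdP.≡-dec ℤP._≟_ BoolP._≟_

open Pairing _≟ᴱ_ reverse (λ (m , b) → cong (m ,_) (BoolP.not-involutive b))
                          (λ (m , b) e → BoolP.not-¬ refl (sym (cong proj₂ e)))

below : ℤ → ℤ → ℤ
below m h = indicator (m <? h)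

x<x+1 : ∀ x → x < x + 1ℤ
x<x+1 x = subst (x <_) (ℤP.+-comm 1ℤ x) (ℤP.suc[i]≤j⇒i<j ℤP.≤-refl)

<⇒+1≤ : ∀ {x m} → x < m → x + 1ℤ ≤ m
<⇒+1≤ {x} x<m = subst (_≤ _) (ℤP.+-comm 1ℤ x) (ℤP.i<j⇒suc[i]≤j x<m)

below-suc : ∀ m x → below m (x + 1ℤ) ≡ indicator (x ℤP.≟ m) + below m x
below-suc m x with ℤP.<-cmp m x
... | tri< m<x m≢x _ = trans (indicator-yes (m <? x + 1ℤ) (ℤP.<-trans m<x (x<x+1 x)))
                         (sym (cong₂ _+_ (indicator-no (x ℤP.≟ m) (m≢x ∘ sym)) (indicator-yes (m <? x) m<x)))
... | tri≈ _ refl _  = trans (indicator-yes (m <? m + 1ℤ) (x<x+1 m))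
                         (sym (cong₂ _+_ (indicator-yes (m ℤP.≟ m) refl) (indicator-no (m <? m) (ℤP.<-irrefl refl))))
... | tri> _ m≢x x<m = trans (indicator-no (m <? x + 1ℤ) (ℤP.≤⇒≯ (<⇒+1≤ x<m)))
                         (sym (cong₂ _+_ (indicator-no (x ℤP.≟ m) (m≢x ∘ sym)) (indicator-no (m <? x) (ℤP.<-asym x<m))))

𝟙-along : ∀ x m b → 𝟙[ (x , b) ≡ (m , b) ] ≡ indicator (x ℤP.≟ m)
𝟙-along x m b = indicator-⇔ (cong proj₁) (cong (_, b)) ((x , b) ≟ᴱ (m , b)) (x ℤP.≟ m)

-- The net number of upward traversals of {m, m+1} telescopes along any walk.
excess-upwards : ∀ m k → excess (m , true) k ≡ below m (target k) - below m (source k)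
excess-upwards m (x , true) = begin
  𝟙[ (x , true) ≡ (m , true) ] - 𝟙[ (x , true) ≡ (m , false) ]   ≡⟨ cong₂ _-_ (𝟙-along x m true) (𝟙-≢ {x , true} {m , false} λ ()) ⟩
  i - 0ℤ                                                          ≡⟨ regroup i (below m x) ⟩
  (i + below m x) - below m x                                     ≡⟨ cong (_- below m x) (sym (below-suc m x)) ⟩
  below m (x + 1ℤ) - below m x                                    ∎
  where
  open ≡-Reasoning
  i = indicator (x ℤP.≟ m)
  regroup : ∀ a b → a - 0ℤ ≡ (a + b) - b
  regroup = solve-∀
excess-upwards m (x , false) = begin
  𝟙[ (x , false) ≡ (m , true) ] - 𝟙[ (x , false) ≡ (m , false) ] ≡⟨ cong₂ _-_ (𝟙-≢ {x , false} {m , true} λ ()) (𝟙-along x m false) ⟩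
  0ℤ - i                                                          ≡⟨ regroup i (below m x) ⟩
  below m x - (i + below m x)                                     ≡⟨ cong (_-_ (below m x)) (sym (below-suc m x)) ⟩
  below m x - below m (x + 1ℤ)                                    ∎
  where
  open ≡-Reasoning
  i = indicator (x ℤP.≟ m)
  regroup : ∀ a b → 0ℤ - a ≡ b - (a + b)
  regroup = solve-∀

module SymmetryFromHomomorphism (H : Graph) (σ : Fin (n H) → Fin 3) (φ : ℤ → Fin 3)
  (γ : Fin (n H) → ℤ) (hom : ∀ u v → Adj H u v → AdjP∞ (γ u) (γ v)) (col : ∀ v → φ (γ v) ≡ σ v)
  (c : Fin 3 → ℕ) where

  V : Set
  V = Fin (n H)

  γ-edge : V × V → OrientedEdge
  γ-edge (u , v) = orientedEdge (γ u) (γ v)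

  weight : OrientedEdge → ℤ
  weight k = + c (φ (target k)) - + c (φ (source k))

  weight-reverse : ∀ k → weight (reverse k) ≡ - weight k
  weight-reverse (m , true)  = difference-swap (+ c (φ m)) (+ c (φ (m + 1ℤ)))
  weight-reverse (m , false) = difference-swap (+ c (φ (m + 1ℤ))) (+ c (φ m))

  weight-γ-edge : ∀ {u v} → Adj H u v → + c (σ v) - + c (σ u) ≡ weight (γ-edge (u , v))
  weight-γ-edge {u} {v} adj = begin
    + c (σ v) - + c (σ u)                      ≡⟨ cong₂ (λ x y → + c x - + c y) (sym (col v)) (sym (col u)) ⟩
    + c (φ (γ v)) - + c (φ (γ u))              ≡⟨ cong₂ (λ x y → + c (φ x) - + c (φ y)) (sym t≡) (sym s≡) ⟩
    weight (γ-edge (u , v))                         ∎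
    where
    open ≡-Reasoning
    s≡ = proj₁ (orientedEdge-endpoints (hom u v adj))
    t≡ = proj₂ (orientedEdge-endpoints (hom u v adj))

  excess-upwards-γ-edge : ∀ m {u v} → Adj H u v → excess (m , true) (γ-edge (u , v)) ≡ below m (γ v) - below m (γ u)
  excess-upwards-γ-edge m {u} {v} adj with orientedEdge-endpoints (hom u v adj)
  ... | s≡ , t≡ = trans (excess-upwards m (γ-edge (u , v))) (cong₂ (λ x y → below m y - below m x) s≡ t≡)

  HasCoefficients-cycleEquation : ∀ vs → AdjacentPairs H (cyclicPairs vs) →
    HasCoefficients γ-edge weight weight-reverse (cycleEquation H σ c vs)
  HasCoefficients-cycleEquation vs adjs = AllP.map⁺ (All.map weight-γ-edge adjs)

  Balanced-cycleEquation : ∀ vs → AdjacentPairs H (cyclicPairs vs) → Balanced γ-edge (cycleEquation H σ c vs)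
  Balanced-cycleEquation vs adjs (m , true) = begin
    sumMap (excess (m , true) ∘ γ-edge ∘ proj₂) (cycleEquation H σ c vs) ≡⟨ sumMap-map _ _ (cyclicPairs vs) ⟩
    sumMap (excess (m , true) ∘ γ-edge) (cyclicPairs vs)                 ≡⟨ sumMap-cong (All.map (excess-upwards-γ-edge m) adjs) ⟩
    sumMap (difference (below m ∘ γ)) (cyclicPairs vs)              ≡⟨ sumMap-difference-cyclicPairs (below m ∘ γ) vs ⟩
    0ℤ                                                              ∎
    where open ≡-Reasoning
  Balanced-cycleEquation vs adjs (m , false) = begin
    sumMap (excess (reverse (m , true)) ∘ γ-edge ∘ proj₂) L  ≡⟨ sumMap-cong (All.universal (excess-op (m , true) ∘ γ-edge ∘ proj₂) L) ⟩
    sumMap (λ t → - excess (m , true) (γ-edge (proj₂ t))) L  ≡⟨ sumMap-neg (excess (m , true) ∘ γ-edge ∘ proj₂) L ⟩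
    - sumMap (excess (m , true) ∘ γ-edge ∘ proj₂) L          ≡⟨ cong -_ (Balanced-cycleEquation vs adjs (m , true)) ⟩
    0ℤ                                                  ∎
    where
    open ≡-Reasoning
    L = cycleEquation H σ c vs

  cycleEquation-Symmetric : ∀ vs → IsCycle H vs → Symmetric (cycleEquation H σ c vs)
  cycleEquation-Symmetric vs (_ , unique , adjs) =
    pairing⇒Symmetric {ts = proj₁ pairing} (subst Unique (sym variables) (Unique-cyclicPairs unique)) (proj₂ pairing)
    where
    pairing = pairUp γ-edge weight weight-reverse _ (HasCoefficients-cycleEquation vs adjs) (Balanced-cycleEquation vs adjs)
    variables : map proj₂ (cycleEquation H σ c vs) ≡ cyclicPairs vs
    variables = trans (sym (ListP.map-∘ (cyclicPairs vs))) (ListP.map-id (cyclicPairs vs))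

module Paths (H : Graph) where

  V : Set
  V = Fin (n H)

  Adj-sym : ∀ {a b} → Adj H a b → Adj H b a
  Adj-sym {a} {b} = trans (Graph.sym H b a)

  Edge : List (V × V) → V → V → Set
  Edge Es a b = Adj H a b × ((a , b) ∈ Es ⊎ (b , a) ∈ Es)

  Edge-there : ∀ {e Es a b} → Edge Es a b → Edge (e ∷ Es) a b
  Edge-there (adj , inj₁ ab∈) = adj , inj₁ (there ab∈)
  Edge-there (adj , inj₂ ba∈) = adj , inj₂ (there ba∈)

  Edge-∷ : ∀ {u v Es a b} → Edge ((u , v) ∷ Es) a b → Edge Es a b ⊎ (a ≡ u × b ≡ v) ⊎ (a ≡ v × b ≡ u)
  Edge-∷ (_   , inj₁ (here refl))  = inj₂ (inj₁ (refl , refl))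
  Edge-∷ (adj , inj₁ (there ab∈)) = inj₁ (adj , inj₁ ab∈)
  Edge-∷ (_   , inj₂ (here refl))  = inj₂ (inj₂ (refl , refl))
  Edge-∷ (adj , inj₂ (there ba∈)) = inj₁ (adj , inj₂ ba∈)

  Edge-[] : ∀ {a b} → ¬ Edge [] a b
  Edge-[] (_ , inj₁ ())
  Edge-[] (_ , inj₂ ())

  Edge-∷-rec : ∀ {u v Es} {Q : V → V → Set} → (∀ {a b} → Edge Es a b → Q a b) → Q u v → Q v u →
               ∀ {a b} → Edge ((u , v) ∷ Es) a b → Q a b
  Edge-∷-rec old new new˘ e with Edge-∷ e
  ... | inj₁ e′                    = old e′
  ... | inj₂ (inj₁ (refl , refl)) = new
  ... | inj₂ (inj₂ (refl , refl)) = new˘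

  data Path (Es : List (V × V)) : V → V → Set where
    []  : ∀ {x} → Path Es x x
    _∷_ : ∀ {x y z} → Edge Es x y → Path Es y z → Path Es x z

  tailVertices : ∀ {Es x y} → Path Es x y → List V
  tailVertices []                = []
  tailVertices (_∷_ {y = y} _ p) = y ∷ tailVertices p

  vertices : ∀ {Es x y} → Path Es x y → List V
  vertices {x = x} p = x ∷ tailVertices p

  Path-there : ∀ {e Es x y} → Path Es x y → Path (e ∷ Es) x y
  Path-there []      = []
  Path-there (e ∷ p) = Edge-there e ∷ Path-there p

  tailVertices-there : ∀ {e Es x y} (p : Path Es x y) → tailVertices (Path-there {e} p) ≡ tailVertices p
  tailVertices-there []      = refl
  tailVertices-there (_ ∷ p) = cong (_ ∷_) (tailVertices-there p)

  _++ᵖ_ : ∀ {Es a b c} → Path Es a b → Path Es b c → Path Es a c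
  []      ++ᵖ q = q
  (e ∷ p) ++ᵖ q = e ∷ (p ++ᵖ q)

  vertices-++ᵖ : ∀ {Es a b c} (p : Path Es a b) (q : Path Es b c) → vertices (p ++ᵖ q) ≡ vertices p ++ tailVertices q
  vertices-++ᵖ []      q = refl
  vertices-++ᵖ {a = a} (e ∷ p) q = cong (a ∷_) (vertices-++ᵖ p q)

  SimplePath : List (V × V) → V → V → Set
  SimplePath Es a b = Σ (Path Es a b) (Unique ∘ vertices)

  SimplePath-there : ∀ {e Es a b} → SimplePath Es a b → SimplePath (e ∷ Es) a b
  SimplePath-there {a = a} (p , unique) = Path-there p , subst (Unique ∘ (a ∷_)) (sym (tailVertices-there p)) unique

  module _ {Es : List (V × V)} (label : V → V) (label-edge : ∀ {a b} → Edge Es a b → label a ≡ label b) where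

    label-vertices : ∀ {x y} (p : Path Es x y) → All (λ z → label z ≡ label x) (vertices p)
    label-vertices []      = refl ∷ []
    label-vertices (e ∷ p) = refl ∷ All.map (λ eq → trans eq (sym (label-edge e))) (label-vertices p)

    label-path : ∀ {x y} → Path Es x y → label x ≡ label y
    label-path []      = refl
    label-path (e ∷ p) = trans (label-edge e) (label-path p)

    bridge : ∀ {e a x y b} → SimplePath Es a x → Edge (e ∷ Es) x y → SimplePath Es y b →
             label x ≢ label y → SimplePath (e ∷ Es) a b
    bridge {a = a} {x} {y} (p , p-simple) xy (q , q-simple) label-x≢y =
      Path-there p ++ᵖ (xy ∷ Path-there q) ,
      subst Unique (sym joined) (UniqueP.++⁺ p-simple q-simple disjoint)
      where
      joined : vertices (Path-there p ++ᵖ (xy ∷ Path-there q)) ≡ vertices p ++ vertices q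
      joined = trans (vertices-++ᵖ (Path-there p) (xy ∷ Path-there q))
                     (cong₂ _++_ (cong (a ∷_) (tailVertices-there p)) (cong (y ∷_) (tailVertices-there q)))
      disjoint : ∀ {z} → ¬ (z ∈ vertices p × z ∈ vertices q)
      disjoint (z∈p , z∈q) =
        label-x≢y (trans (sym (trans (All.lookup (label-vertices p) z∈p) (label-path p)))
                         (All.lookup (label-vertices q) z∈q))

orientStep : {V : Set} → (V → Fin 3) → V × V → ℤ
orientStep σ (u , v) = orient (σ u) (σ v)

CycleEquationsSymmetric : (H : Graph) → (Fin (n H) → Fin 3) → Set
CycleEquationsSymmetric H σ =
  ∀ (c : Fin 3 → ℕ) → IsColourInjection c → ∀ vs → IsCycle H vs → Symmetric (cycleEquation H σ c vs)

symmetric⇒winding≡0 : (H : Graph) (σ : Fin (n H) → Fin 3) → ProperColouring H σ →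
  CycleEquationsSymmetric H σ → ∀ vs → IsCycle H vs → sumMap (orientStep σ) (cyclicPairs vs) ≡ 0ℤ
symmetric⇒winding≡0 H σ proper symmetric vs cycle@(_ , _ , adjs) = begin
  sumMap (orientStep σ) (cyclicPairs vs)
    ≡⟨ sumMap-cong (All.map (λ adj → sym (decodeOrient-c₀ (proper _ _ adj))) adjs) ⟩
  sumMap (λ (u , v) → decodeOrient (+ c₀ (σ v) - + c₀ (σ u))) (cyclicPairs vs)
    ≡⟨ sym (sumMap-map (decodeOrient ∘ proj₁) _ (cyclicPairs vs)) ⟩
  sumMap (decodeOrient ∘ proj₁) (cycleEquation H σ c₀ vs)
    ≡⟨ sumMap-odd-Symmetric decodeOrient decodeOrient-odd (symmetric c₀ c₀-isColourInjection vs cycle) ⟩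
  0ℤ ∎
  where open ≡-Reasoning

module HomomorphismFromWinding (H : Graph) (σ : Fin (n H) → Fin 3) (proper : ProperColouring H σ)
  (φ : ℤ → Fin 3) (cyclic : IsCyclicColouring φ)
  (winding≡0 : ∀ vs → IsCycle H vs → sumMap (orientStep σ) (cyclicPairs vs) ≡ 0ℤ) where

  open Paths H
  open CyclicColouring φ cyclic

  -- A colour homomorphism of the spanning subgraph with edge set Es, together
  -- with a labelling whose classes are exactly its connected components.
  record PartialHom (Es : List (V × V)) : Set where
    field
      γ          : V → ℤ
      colour     : ∀ v → φ (γ v) ≡ σ v
      hom        : ∀ {a b} → Edge Es a b → AdjP∞ (γ a) (γ b)
      label      : V → V
      label-edge : ∀ {a b} → Edge Es a b → label a ≡ label b
      connected  : ∀ {a b} → label a ≡ label b → SimplePath Es a b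

  module _ {Es} (P : PartialHom Es) where
    open PartialHom P

    orientStep-Edge : ∀ {a b} → Edge Es a b → orientStep σ (a , b) ≡ γ b - γ a
    orientStep-Edge {a} {b} e =
      subst₂ (λ s t → orient s t ≡ γ b - γ a) (colour a) (colour b) (orient-AdjP∞ (hom e))

    winding-path : ∀ {x y} (p : Path Es x y) w →
      sumMap (orientStep σ) (zip (x ∷ tailVertices p) (tailVertices p ++ [ w ])) ≡ (γ y - γ x) + orientStep σ (y , w)
    winding-path {x} [] w = empty-path (γ x) (orientStep σ (x , w))
      where
      empty-path : ∀ g s → s + 0ℤ ≡ (g - g) + s
      empty-path = solve-∀
    winding-path {x} {y} (_∷_ {y = z} e p) w =
      trans (cong₂ _+_ (orientStep-Edge e) (winding-path p w)) (telescope (γ x) (γ z) (γ y) (orientStep σ (y , w)))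
      where
      telescope : ∀ a b c s → (b - a) + ((c - b) + s) ≡ (c - a) + s
      telescope = solve-∀

    path-adjacent : ∀ {x y w} (p : Path Es x y) → Adj H y w →
      AdjacentPairs H (zip (x ∷ tailVertices p) (tailVertices p ++ [ w ]))
    path-adjacent []      yw = yw ∷ []
    path-adjacent (e ∷ p) yw = proj₁ e ∷ path-adjacent p yw

    -- A simple path from x to y closed by the edge yx is a cycle, whose winding is 0.
    close : ∀ {x y} → Adj H y x → SimplePath Es x y → AdjP∞ (γ y) (γ x)
    close yx ([] , _)       = ⊥-elim (Graph.irrfl H _ yx)
    close yx (e ∷ [] , _)   = AdjP∞-sym (hom e)
    close {x} {y} yx (p@(_ ∷ _ ∷ _) , simple) = AdjP∞-±1 (orient-±1 (proper y x yx)) (begin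
      (γ y - γ x) + orientStep σ (y , x)      ≡⟨ sym (winding-path p x) ⟩
      sumMap (orientStep σ) (cyclicPairs (vertices p))
                                              ≡⟨ winding≡0 (vertices p) (s≤s (s≤s (s≤s z≤n)) , simple , path-adjacent p yx) ⟩
      0ℤ                                      ∎)
      where open ≡-Reasoning

  extend-nonEdge : ∀ {Es u v} → ¬ Adj H u v → PartialHom Es → PartialHom ((u , v) ∷ Es)
  extend-nonEdge {Es} {u} {v} ¬uv P = record
    { γ = γ ; colour = colour ; hom = λ e → hom (old e)
    ; label = label ; label-edge = λ e → label-edge (old e)
    ; connected = SimplePath-there ∘ connected }
    where
    open PartialHom P
    old : ∀ {a b} → Edge ((u , v) ∷ Es) a b → Edge Es a b
    old e with Edge-∷ e
    ... | inj₁ e′                    = e′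
    ... | inj₂ (inj₁ (refl , refl)) = contradiction (proj₁ e) ¬uv
    ... | inj₂ (inj₂ (refl , refl)) = contradiction (Adj-sym (proj₁ e)) ¬uv

  extend-cycle : ∀ {Es u v} → Adj H u v → (P : PartialHom Es) → PartialHom.label P u ≡ PartialHom.label P v →
    PartialHom ((u , v) ∷ Es)
  extend-cycle {Es} {u} {v} uv P same = record
    { γ = γ ; colour = colour
    ; hom = Edge-∷-rec hom uv∞ (AdjP∞-sym uv∞)
    ; label = label ; label-edge = Edge-∷-rec label-edge same (sym same)
    ; connected = SimplePath-there ∘ connected }
    where
    open PartialHom P
    uv∞ : AdjP∞ (γ u) (γ v)
    uv∞ = close P uv (connected (sym same))

  -- The new edge uv joins two components: the component of v is translated
  -- along P∞ so that v lands on the neighbour of γ u of colour σ v.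
  module Bridge {Es u v} (uv : Adj H u v) (P : PartialHom Es)
                (distinct : PartialHom.label P u ≢ PartialHom.label P v) where
    open PartialHom P

    t : ℤ
    t = (γ u + orientStep σ (u , v)) - γ v

    offset : V → ℤ
    offset x = if does (label x FinP.≟ label v) then t else 0ℤ

    label′ : V → V
    label′ x = if does (label x FinP.≟ label v) then label u else label x

    γ′ : V → ℤ
    γ′ x = γ x + offset x

    data Side (x : V) : Set where
      inside  : label x ≡ label v → offset x ≡ t   → label′ x ≡ label u → Side x
      outside : label x ≢ label v → offset x ≡ 0ℤ → label′ x ≡ label x → Side x

    side : ∀ x → Side x
    side x with label x FinP.≟ label v in decision
    ... | yes x∈v = inside x∈v (cong (λ d → if does d then t else 0ℤ) decision)
                               (cong (λ d → if does d then label u else label x) decision)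
    ... | no x∉v  = outside x∉v (cong (λ d → if does d then t else 0ℤ) decision)
                                (cong (λ d → if does d then label u else label x) decision)

    landing : φ (γ v + t) ≡ σ v
    landing = begin
      φ (γ v + t)                            ≡⟨ cong φ (+-minus-cancel (γ v) (γ u + orientStep σ (u , v))) ⟩
      φ (γ u + orient (σ u) (σ v))           ≡⟨ cong (λ s → φ (γ u + orient s (σ v))) (sym (colour u)) ⟩
      φ (γ u + orient (φ (γ u)) (σ v))       ≡⟨ φ-orient (λ e → proper u v uv (trans (sym (colour u)) e)) ⟩
      σ v                                    ∎
      where open ≡-Reasoning

    colour′ : ∀ x → φ (γ′ x) ≡ σ x
    colour′ x with side x
    ... | inside _ off _ rewrite off =
      trans (φ-period (trans landing (sym (colour v))) (γ x)) (colour x)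
    ... | outside _ off _ rewrite off = trans (cong φ (ℤP.+-identityʳ (γ x))) (colour x)

    offset-cong : ∀ {a b} → label a ≡ label b → offset a ≡ offset b
    offset-cong {a} {b} ab with side a | side b
    ... | inside _ oa _   | inside _ ob _   = trans oa (sym ob)
    ... | outside _ oa _  | outside _ ob _  = trans oa (sym ob)
    ... | inside a∈v _ _  | outside b∉v _ _ = contradiction (trans (sym ab) a∈v) b∉v
    ... | outside a∉v _ _ | inside b∈v _ _  = contradiction (trans ab b∈v) a∉v

    label′-cong : ∀ {a b} → label a ≡ label b → label′ a ≡ label′ b
    label′-cong {a} {b} ab with side a | side b
    ... | inside _ _ la   | inside _ _ lb   = trans la (sym lb)
    ... | outside _ _ la  | outside _ _ lb  = trans la (trans ab (sym lb))
    ... | inside a∈v _ _  | outside b∉v _ _ = contradiction (trans (sym ab) a∈v) b∉v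
    ... | outside a∉v _ _ | inside b∈v _ _  = contradiction (trans ab b∈v) a∉v

    hom′ : ∀ {a b} → Edge Es a b → AdjP∞ (γ′ a) (γ′ b)
    hom′ {a} {b} e = subst (λ o → AdjP∞ (γ′ a) (γ b + o)) (offset-cong (label-edge e))
                           (AdjP∞-translate (offset a) (hom e))

    label′-edge : ∀ {a b} → Edge Es a b → label′ a ≡ label′ b
    label′-edge = label′-cong ∘ label-edge

    u-outside : offset u ≡ 0ℤ × label′ u ≡ label u
    u-outside with side u
    ... | inside u∈v _ _   = contradiction u∈v distinct
    ... | outside _ ou lu = ou , lu

    v-inside : offset v ≡ t × label′ v ≡ label u
    v-inside with side v
    ... | inside _ ov lv  = ov , lv
    ... | outside v∉v _ _ = contradiction refl v∉v

    uv∞ : AdjP∞ (γ′ u) (γ′ v)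
    uv∞ = subst₂ AdjP∞ (sym γ′u) (sym γ′v) (AdjP∞-+±1 (orient-±1 (proper u v uv)))
      where
      γ′u : γ′ u ≡ γ u
      γ′u = trans (cong (_+_ (γ u)) (proj₁ u-outside)) (ℤP.+-identityʳ (γ u))
      γ′v : γ′ v ≡ γ u + orientStep σ (u , v)
      γ′v = trans (cong (_+_ (γ v)) (proj₁ v-inside)) (+-minus-cancel (γ v) (γ u + orientStep σ (u , v)))

    label′-uv : label′ u ≡ label′ v
    label′-uv = trans (proj₂ u-outside) (sym (proj₂ v-inside))

    connected′ : ∀ {a b} → label′ a ≡ label′ b → SimplePath ((u , v) ∷ Es) a b
    connected′ {a} {b} ab with side a | side b
    ... | inside a∈v _ _  | inside b∈v _ _  = SimplePath-there (connected (trans a∈v (sym b∈v)))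
    ... | outside _ _ la  | outside _ _ lb  = SimplePath-there (connected (trans (sym la) (trans ab lb)))
    ... | inside a∈v _ la | outside _ _ lb  =
      bridge label label-edge (connected a∈v) (Adj-sym uv , inj₂ (here refl))
             (connected (trans (sym la) (trans ab lb))) (distinct ∘ sym)
    ... | outside _ _ la  | inside b∈v _ lb =
      bridge label label-edge (connected (trans (sym la) (trans ab lb))) (uv , inj₁ (here refl))
             (connected (sym b∈v)) distinct

    extended : PartialHom ((u , v) ∷ Es)
    extended = record
      { γ = γ′ ; colour = colour′
      ; hom = Edge-∷-rec hom′ uv∞ (AdjP∞-sym uv∞)
      ; label = label′ ; label-edge = Edge-∷-rec label′-edge label′-uv (sym label′-uv)
      ; connected = connected′ }

  discrete : PartialHom []
  discrete = record
    { γ = proj₁ ∘ φ-surjective ∘ σ ; colour = proj₂ ∘ φ-surjective ∘ σ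
    ; hom = ⊥-elim ∘ Edge-[]
    ; label = λ x → x ; label-edge = ⊥-elim ∘ Edge-[]
    ; connected = λ { refl → [] , [] ∷ [] } }

  extend : ∀ {Es} u v → PartialHom Es → PartialHom ((u , v) ∷ Es)
  extend u v P with adj H u v BoolP.≟ true | PartialHom.label P u FinP.≟ PartialHom.label P v
  ... | no ¬uv | _          = extend-nonEdge ¬uv P
  ... | yes uv | yes same   = extend-cycle uv P same
  ... | yes uv | no distinct = Bridge.extended uv P distinct

  build : ∀ Es → PartialHom Es
  build []             = discrete
  build ((u , v) ∷ Es) = extend u v (build Es)

  colourHomomorphic : ColourHomomorphic H σ φ
  colourHomomorphic = γ , (λ u v uv → hom (uv , inj₁ (MemP.∈-cartesianProduct⁺ (MemP.∈-allFin u) (MemP.∈-allFin v)))) , colour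
    where open PartialHom (build (cartesianProduct (allFin (n H)) (allFin (n H))))

theorem4p3 : (H : Graph) (σ : Fin (n H) → Fin 3) → ProperColouring H σ →
    (φ : ℤ → Fin 3) → IsCyclicColouring φ →
    ((∀ (c : Fin 3 → ℕ) → IsColourInjection c →
        ∀ (vs : List (Fin (n H))) → IsCycle H vs → Symmetric (cycleEquation H σ c vs))
      → ColourHomomorphic H σ φ)
    × (ColourHomomorphic H σ φ →
        ∀ (c : Fin 3 → ℕ) → IsColourInjection c →
        ∀ (vs : List (Fin (n H))) → IsCycle H vs → Symmetric (cycleEquation H σ c vs))
theorem4p3 H σ proper φ cyclic =
  (λ symmetric → HomomorphismFromWinding.colourHomomorphic H σ proper φ cyclic (symmetric⇒winding≡0 H σ proper symmetric)) ,
  (λ { (γ , hom , col) c _ → SymmetryFromHomomorphism.cycleEquation-Symmetric H σ φ γ hom col c })
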